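{- Let $p=12$. Suppose $v$ is a cube-free word over $\mathbb{N}$ and $a\in\mathbb{N}$ is a letter such that $va\in\widetilde{\mathcal{C}}^{(p)}$ and $va=uyy$ for some words $u,y$ with $|y|>p$. Then $\Gamma(va)=\Gamma(yy)$.
   Context: Words are finite sequences of letters from $\mathbb{N}$; $\varepsilon$ is the empty word. A cube is a word $uuu$ with $u$ nonempty; its period is $|u|$; a word is cube-free if it has no cube as a factor. $\widetilde{\mathcal{C}}^{(p)}$ is the set of words over $\mathbb{N}$ containing no factor $uuu$ with $1\le|u|\le p$. A minimal cube is a cube that contains no other cube as a proper factor. A word is normalized if it is lexicographically smallest among all words obtained from it by applying a permutation of $\mathbb{N}$ letterwise. $\Gamma$ denotes the set of normalized proper prefixes (including $\varepsilon$) of minimal cubes of period at most $p$. For any word $w$, $\Gamma(w)$ denotes the longest element of $\Gamma$ that equals the image, under some permutation of $\mathbb{N}$ applied letterwise, of a suffix of $w$. -}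

module Defs where

open import Data.Nat using (ℕ; _<_; _≤_; _*_; suc)
open import Data.List using (List; []; _∷_; _++_; map; length)
open import Data.Product using (Σ; ∃; _×_; _,_)
open import Relation.Binary.PropositionalEquality using (_≡_)
open import Relation.Nullary using (¬_)
open import Function.Bundles using (_↔_; Inverse)

Word : Set
Word = List ℕ

Factor : Word → Word → Set
Factor f w = ∃ λ x → ∃ λ z → w ≡ x ++ f ++ z

Suffix : Word → Word → Set
Suffix s w = ∃ λ x → w ≡ x ++ s

CubeOfPeriod : ℕ → Word → Set
CubeOfPeriod n c = ∃ λ u → 1 ≤ length u × length u ≡ n × c ≡ u ++ u ++ u

IsCube : Word → Set
IsCube c = ∃ λ u → 1 ≤ length u × c ≡ u ++ u ++ u

CubeFree : Word → Set
CubeFree w = ¬ (∃ λ c → IsCube c × Factor c w)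

Ctilde : ℕ → Word → Set
Ctilde p w = ¬ (∃ λ u → 1 ≤ length u × length u ≤ p × Factor (u ++ u ++ u) w)

MinimalCube : Word → Set
MinimalCube c = IsCube c × (∀ f → Factor f c → ¬ (f ≡ c) → ¬ IsCube f)

Perm : Set
Perm = ℕ ↔ ℕ

apply : Perm → Word → Word
apply π w = map (Inverse.to π) w

data _≤ₗ_ : Word → Word → Set where
  []≤ : ∀ {w} → [] ≤ₗ w
  <∷  : ∀ {a b w w'} → a < b → (a ∷ w) ≤ₗ (b ∷ w')
  ≡∷  : ∀ {a w w'} → w ≤ₗ w' → (a ∷ w) ≤ₗ (a ∷ w')

Normalized : Word → Set
Normalized w = ∀ (π : Perm) → w ≤ₗ apply π w

ProperPrefix : Word → Word → Set
ProperPrefix g c = ∃ λ s → 1 ≤ length s × c ≡ g ++ s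

InΓ : ℕ → Word → Set
InΓ p g = Normalized g ×
  (∃ λ c → ∃ λ n → 1 ≤ n × n ≤ p × CubeOfPeriod n c × MinimalCube c × ProperPrefix g c)

MatchesSuffix : Word → Word → Set
MatchesSuffix w g = ∃ λ (π : Perm) → ∃ λ s → Suffix s w × apply π s ≡ g

IsΓOf : ℕ → Word → Word → Set
IsΓOf p w g = InΓ p g × MatchesSuffix w g ×
  (∀ g' → InΓ p g' → MatchesSuffix w g' → length g' ≤ length g)

-- Every element of Γ has a period n ≤ p, being a prefix of a cube of period n, and periods
-- are reflected by permutations of the alphabet.  If an element of Γ matched a suffix of
-- u y y longer than y y, then y y would have the periods n and |y|; as n + |y| ≤ |y y|,
-- the weak Fine–Wilf theorem gives the period d = gcd n |y|, a proper divisor of |y|.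
-- Then 3d ≤ |y y|, so y y begins with a cube of period d ≤ p, which C̃⁽ᵖ⁾ forbids.  Hence
-- the suffixes of u y y that can be matched by elements of Γ are exactly those of y y.
module Submission where

open import Defs
open import Data.Nat using (ℕ; _<_)
open import Data.List using (List; [_]; _++_; length)
open import Relation.Binary.PropositionalEquality using (_≡_)
open import Function.Bundles using (_⇔_)

open import Data.Nat using (zero; suc; _+_; _*_; _≤_; _≤?_; s≤s; z<s; >-nonZero)
open import Data.Nat.Properties
open import Data.Nat.Divisibility using (_∣_; divides-refl; ∣⇒≤)
open import Data.Nat.GCD using (gcd; GCD; gcd-GCD; gcd[m,n]∣m; gcd[m,n]∣n; gcd[m,n]≢0)
open import Data.Nat.Induction using (<-wellFounded)
open import Induction.WellFounded using (Acc; acc)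
open import Data.List using ([]; _∷_; map; take; drop)
open import Data.List.Properties
  using (++-assoc; ∷-injectiveʳ; length-++; length-map; length-drop; length-take; take++drop≡id)
open import Data.Maybe using (Maybe; just; nothing)
import Data.Maybe as Maybe
open import Data.Maybe.Properties using (map-injective)
open import Data.Product using (∃; _×_; _,_)
open import Data.Sum using (_⊎_; inj₁; inj₂)
open import Relation.Nullary using (¬_; yes; no; contradiction)
open import Relation.Binary.PropositionalEquality
  using (refl; sym; trans; cong; subst; module ≡-Reasoning)
open import Function.Bundles using (Injection; mk⇔)
open import Function.Properties.Inverse using (↔⇒↣)

open ≡-Reasoning

at : Word → ℕ → Maybe ℕ
at []      _       = nothing
at (x ∷ w) zero    = just x
at (x ∷ w) (suc i) = at w i

at-extensional : ∀ v w → (∀ i → at v i ≡ at w i) → v ≡ w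
at-extensional []      []      _ = refl
at-extensional []      (_ ∷ _) h with () ← h 0
at-extensional (_ ∷ _) []      h with () ← h 0
at-extensional (x ∷ v) (y ∷ w) h with refl ← h 0 =
  cong (x ∷_) (at-extensional v w (λ i → h (suc i)))

at-++ˡ : ∀ v w {i} → i < length v → at (v ++ w) i ≡ at v i
at-++ˡ (x ∷ v) w {zero}  _       = refl
at-++ˡ (x ∷ v) w {suc i} (s≤s i<) = at-++ˡ v w i<

at-++ʳ : ∀ v w i → at (v ++ w) (length v + i) ≡ at w i
at-++ʳ []      w i = refl
at-++ʳ (x ∷ v) w i = at-++ʳ v w i

at-drop : ∀ k w i → at (drop k w) i ≡ at w (k + i)
at-drop zero    w       i = refl
at-drop (suc k) []      i = refl
at-drop (suc k) (x ∷ w) i = at-drop k w i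

at-take-< : ∀ k w {i} → i < k → at (take k w) i ≡ at w i
at-take-< (suc k) []      _               = refl
at-take-< (suc k) (x ∷ w) {zero}  _       = refl
at-take-< (suc k) (x ∷ w) {suc i} (s≤s i<) = at-take-< k w i<

at-take-≥ : ∀ k w {i} → k ≤ i → at (take k w) i ≡ nothing
at-take-≥ zero    w       _        = refl
at-take-≥ (suc k) []      _        = refl
at-take-≥ (suc k) (x ∷ w) (s≤s k≤) = at-take-≥ k w k≤

at-map : ∀ (f : ℕ → ℕ) w i → at (map f w) i ≡ Maybe.map f (at w i)
at-map f []      i       = refl
at-map f (x ∷ w) zero    = refl
at-map f (x ∷ w) (suc i) = at-map f w i

HasPeriod : Word → ℕ → Set
HasPeriod w p = ∀ i → i + p < length w → at w i ≡ at w (i + p)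

hasPeriod-∷⁻ : ∀ {x w p} → HasPeriod (x ∷ w) p → HasPeriod w p
hasPeriod-∷⁻ P i lt = P (suc i) (s≤s lt)

hasPeriod-++⁻ʳ : ∀ v {w p} → HasPeriod (v ++ w) p → HasPeriod w p
hasPeriod-++⁻ʳ []      P = P
hasPeriod-++⁻ʳ (x ∷ v) P = hasPeriod-++⁻ʳ v (hasPeriod-∷⁻ P)

hasPeriod-drop : ∀ k w {p} → HasPeriod w p → HasPeriod (drop k w) p
hasPeriod-drop zero    w       P = P
hasPeriod-drop (suc k) []      P = P
hasPeriod-drop (suc k) (x ∷ w) P = hasPeriod-drop k w (hasPeriod-∷⁻ P)

hasPeriod-++⁻ˡ : ∀ v w {p} → HasPeriod (v ++ w) p → HasPeriod v p
hasPeriod-++⁻ˡ v w {p} P i lt = begin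
  at v i              ≡⟨ at-++ˡ v w (m+n≤o⇒m≤o (suc i) lt) ⟨
  at (v ++ w) i       ≡⟨ P i (subst (i + p <_) (sym (length-++ v)) (≤-trans lt (m≤m+n _ _))) ⟩
  at (v ++ w) (i + p) ≡⟨ at-++ˡ v w lt ⟩
  at v (i + p)        ∎

hasPeriod-map⁻ : ∀ {f : ℕ → ℕ} → (∀ {a b} → f a ≡ f b → a ≡ b) →
                 ∀ w {p} → HasPeriod (map f w) p → HasPeriod w p
hasPeriod-map⁻ {f} f-inj w {p} P i lt = map-injective f-inj (begin
  Maybe.map f (at w i)       ≡⟨ at-map f w i ⟨
  at (map f w) i             ≡⟨ P i (subst (i + p <_) (sym (length-map f w)) lt) ⟩
  at (map f w) (i + p)       ≡⟨ at-map f w (i + p) ⟩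
  Maybe.map f (at w (i + p)) ∎)

prefix⇒hasPeriod : ∀ u w t → u ++ w ≡ w ++ t → HasPeriod (u ++ w) (length u)
prefix⇒hasPeriod u w t uw≡wt i lt = begin
  at (u ++ w) i              ≡⟨ cong (λ v → at v i) uw≡wt ⟩
  at (w ++ t) i              ≡⟨ at-++ˡ w t i<|w| ⟩
  at w i                     ≡⟨ at-++ʳ u w i ⟨
  at (u ++ w) (length u + i) ≡⟨ cong (at (u ++ w)) (+-comm (length u) i) ⟩
  at (u ++ w) (i + length u) ∎
  where
  i<|w| : i < length w
  i<|w| = +-cancelʳ-< (length u) i (length w)
    (subst (i + length u <_) (trans (length-++ u) (+-comm (length u) (length w))) lt)

square-hasPeriod : ∀ y → HasPeriod (y ++ y) (length y)
square-hasPeriod y = prefix⇒hasPeriod y y y refl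

cube-hasPeriod : ∀ u → HasPeriod (u ++ u ++ u) (length u)
cube-hasPeriod u = prefix⇒hasPeriod u (u ++ u) u (sym (++-assoc u u u))

hasPeriod-difference : ∀ w p k → HasPeriod w p → HasPeriod w (p + k) →
                       p + (p + k) ≤ length w → HasPeriod w k
hasPeriod-difference w p k Pp Pp+k L i lt with p ≤? i
... | yes p≤i with j , refl ← m≤n⇒∃[o]m+o≡n p≤i = begin
  at w (p + j)           ≡⟨ cong (at w) (+-comm p j) ⟩
  at w (j + p)           ≡⟨ Pp j (subst (_< length w) (+-comm p j) (m+n≤o⇒m≤o (suc (p + j)) lt)) ⟨
  at w j                 ≡⟨ Pp+k j (subst (_< length w) (sym j+[p+k]≡p+j+k) lt) ⟩
  at w (j + (p + k))     ≡⟨ cong (at w) j+[p+k]≡p+j+k ⟩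
  at w (p + j + k)       ∎
  where
  j+[p+k]≡p+j+k : j + (p + k) ≡ p + j + k
  j+[p+k]≡p+j+k = trans (sym (+-assoc j p k)) (cong (_+ k) (+-comm j p))
... | no p≰i = begin
  at w i                 ≡⟨ Pp+k i (<-≤-trans i+[p+k]<p+[p+k] L) ⟩
  at w (i + (p + k))     ≡⟨ cong (at w) i+[p+k]≡i+k+p ⟩
  at w (i + k + p)       ≡⟨ Pp (i + k) (subst (_< length w) i+[p+k]≡i+k+p (<-≤-trans i+[p+k]<p+[p+k] L)) ⟨
  at w (i + k)           ∎
  where
  i+[p+k]<p+[p+k] : i + (p + k) < p + (p + k)
  i+[p+k]<p+[p+k] = +-monoˡ-< (p + k) (≰⇒> p≰i)
  i+[p+k]≡i+k+p : i + (p + k) ≡ i + k + p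
  i+[p+k]≡i+k+p = trans (cong (i +_) (+-comm p k)) (sym (+-assoc i k p))

-- The subtractive Euclidean algorithm, carried along with the period.
hasPeriod-GCD : ∀ w p q → Acc _<_ (p + q) → HasPeriod w p → HasPeriod w q →
                p + q ≤ length w → ∃ λ d → GCD p q d × HasPeriod w d
hasPeriod-GCD w zero      q         _         _  Pq _ = q , GCD.base , Pq
hasPeriod-GCD w p@(suc _) zero      _         Pp _  _ = p , GCD.sym GCD.base , Pp
hasPeriod-GCD w p@(suc _) q@(suc _) (acc rec) Pp Pq L with ≤-total p q
... | inj₁ p≤q with k , refl ← m≤n⇒∃[o]m+o≡n p≤q
  with d , isGCD , Pd ← hasPeriod-GCD w p k (rec (+-monoʳ-< p (m<n+m k z<s)))
                          Pp (hasPeriod-difference w p k Pp Pq L) (≤-trans (m≤n+m (p + k) p) L)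
  = d , GCD.step isGCD , Pd
hasPeriod-GCD w p@(suc _) q@(suc _) (acc rec) Pp Pq L
    | inj₂ q≤p with k , refl ← m≤n⇒∃[o]m+o≡n q≤p
  with d , isGCD , Pd ← hasPeriod-GCD w k q (rec (+-monoˡ-< q (m<n+m k z<s)))
                          (hasPeriod-difference w q k Pq Pp (subst (_≤ length w) (+-comm (q + k) q) L))
                          Pq (≤-trans (+-monoˡ-≤ q (m≤n+m k q)) L)
  = d , GCD.sym (GCD.step (GCD.sym isGCD)) , Pd

gcd-hasPeriod : ∀ w p q → HasPeriod w p → HasPeriod w q → p + q ≤ length w →
                HasPeriod w (gcd p q)
gcd-hasPeriod w p q Pp Pq L with d , isGCD , Pd ← hasPeriod-GCD w p q (<-wellFounded (p + q)) Pp Pq L =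
  subst (HasPeriod w) (GCD.unique isGCD (gcd-GCD p q)) Pd

take-drop-hasPeriod : ∀ w p → HasPeriod w p → p + p ≤ length w → take p (drop p w) ≡ take p w
take-drop-hasPeriod w p P L = at-extensional _ _ pointwise
  where
  pointwise : ∀ i → at (take p (drop p w)) i ≡ at (take p w) i
  pointwise i with i <? p
  ... | yes i<p = begin
    at (take p (drop p w)) i ≡⟨ at-take-< p (drop p w) i<p ⟩
    at (drop p w) i          ≡⟨ at-drop p w i ⟩
    at w (p + i)             ≡⟨ cong (at w) (+-comm p i) ⟩
    at w (i + p)             ≡⟨ P i (<-≤-trans (+-monoˡ-< p i<p) L) ⟨
    at w i                   ≡⟨ at-take-< p w i<p ⟨
    at (take p w) i          ∎
  ... | no i≮p = trans (at-take-≥ p (drop p w) (≮⇒≥ i≮p)) (sym (at-take-≥ p w (≮⇒≥ i≮p)))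

unroll-hasPeriod : ∀ w p → HasPeriod w p → p + p ≤ length w →
                   w ≡ take p w ++ take p w ++ drop p (drop p w)
unroll-hasPeriod w p P L = begin
  w                                             ≡⟨ take++drop≡id p w ⟨
  take p w ++ drop p w                          ≡⟨ cong (take p w ++_) (take++drop≡id p (drop p w)) ⟨
  take p w ++ take p (drop p w) ++ drop p (drop p w)
    ≡⟨ cong (λ z → take p w ++ z ++ drop p (drop p w)) (take-drop-hasPeriod w p P L) ⟩
  take p w ++ take p w ++ drop p (drop p w)     ∎

hasPeriod⇒cube-prefix : ∀ w p → HasPeriod w p → p + p + p ≤ length w →
                        ∃ λ z → length z ≡ p × ∃ λ r → w ≡ z ++ z ++ z ++ r
hasPeriod⇒cube-prefix w p P L = z , |z|≡p , r , (begin
  w                    ≡⟨ take++drop≡id p w ⟨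
  z ++ w₁              ≡⟨ cong (z ++_) (unroll-hasPeriod w₁ p (hasPeriod-drop p w P) L₁) ⟩
  z ++ z₁ ++ z₁ ++ r   ≡⟨ cong (λ x → z ++ x ++ x ++ r) (take-drop-hasPeriod w p P (m+n≤o⇒m≤o (p + p) L)) ⟩
  z ++ z ++ z ++ r     ∎)
  where
  z  = take p w
  w₁ = drop p w
  z₁ = take p w₁
  r  = drop p (drop p w₁)
  |z|≡p : length z ≡ p
  |z|≡p = trans (length-take p w) (m≤n⇒m⊓n≡m (≤-trans (m≤m+n p p) (m+n≤o⇒m≤o (p + p) L)))
  L₁ : p + p ≤ length w₁
  L₁ = subst (p + p ≤_) (sym (length-drop p w)) (m+n≤o⇒m≤o∸n (p + p) L)

Ctilde-++⁻ʳ : ∀ {p} u {w} → Ctilde p (u ++ w) → Ctilde p w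
Ctilde-++⁻ʳ u {w} C (c , 1≤|c| , |c|≤p , x , r , w≡xcr) =
  C (c , 1≤|c| , |c|≤p , u ++ x , r , trans (cong (u ++_) w≡xcr) (sym (++-assoc u x _)))

Ctilde-hasPeriod : ∀ {p w d} → Ctilde p w → 1 ≤ d → d ≤ p → HasPeriod w d → ¬ (d + d + d ≤ length w)
Ctilde-hasPeriod {w = w} {d} C 1≤d d≤p P L =
  let z , |z|≡d , r , w≡zzzr = hasPeriod⇒cube-prefix w d P L
  in  C (z , subst (1 ≤_) (sym |z|≡d) 1≤d , subst (_≤ _) (sym |z|≡d) d≤p , [] , r ,
         trans w≡zzzr (sym (trans (++-assoc z (z ++ z) r) (cong (z ++_) (++-assoc z z r)))))

m∣n∧m<n⇒m+m≤n : ∀ {m n} → m ∣ n → m < n → m + m ≤ n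
m∣n∧m<n⇒m+m≤n {m} (divides-refl (suc (suc q))) _ = +-monoʳ-≤ m (m≤m+n m (q * m))
m∣n∧m<n⇒m+m≤n {m} (divides-refl 1) m<m+0 = contradiction (subst (m <_) (+-identityʳ m) m<m+0) (n≮n m)

square-noShortPeriod : ∀ {p} y {n} → Ctilde p (y ++ y) → p < length y → 1 ≤ n → n ≤ p →
                       ¬ HasPeriod (y ++ y) n
square-noShortPeriod {p} y {n} C p<m 1≤n n≤p Pn = Ctilde-hasPeriod C 1≤d d≤p Pd 3d≤|yy|
  where
  m = length y
  d = gcd n m
  n≤m : n ≤ m
  n≤m = ≤-trans n≤p (<⇒≤ p<m)
  Pd : HasPeriod (y ++ y) d
  Pd = gcd-hasPeriod (y ++ y) n m Pn (square-hasPeriod y)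
         (subst (n + m ≤_) (sym (length-++ y)) (+-monoˡ-≤ m n≤m))
  1≤d : 1 ≤ d
  1≤d = n≢0⇒n>0 (gcd[m,n]≢0 n m (inj₁ (n>0⇒n≢0 1≤n)))
  d≤p : d ≤ p
  d≤p = ≤-trans (∣⇒≤ {{>-nonZero 1≤n}} (gcd[m,n]∣m n m)) n≤p
  d+d≤m : d + d ≤ m
  d+d≤m = m∣n∧m<n⇒m+m≤n (gcd[m,n]∣n n m) (≤-<-trans d≤p p<m)
  3d≤|yy| : d + d + d ≤ length (y ++ y)
  3d≤|yy| = subst (d + d + d ≤_) (sym (length-++ y)) (+-mono-≤ d+d≤m (m+n≤o⇒m≤o d d+d≤m))

Γ-hasPeriod : ∀ {p g} → InΓ p g → ∃ λ n → 1 ≤ n × n ≤ p × HasPeriod g n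
Γ-hasPeriod {g = g} (_ , c , n , 1≤n , n≤p , (u , _ , refl , refl) , _ , s , _ , uuu≡gs) =
  n , 1≤n , n≤p , hasPeriod-++⁻ˡ g s (subst (λ c → HasPeriod c n) uuu≡gs (cube-hasPeriod u))

suffixes-comparable : ∀ x s u w → x ++ s ≡ u ++ w → Suffix w s ⊎ Suffix s w
suffixes-comparable []      s u       w e = inj₁ (u , e)
suffixes-comparable (a ∷ x) s []      w e = inj₂ (a ∷ x , sym e)
suffixes-comparable (a ∷ x) s (b ∷ u) w e = suffixes-comparable x s u w (∷-injectiveʳ e)

matchesSuffix-++ : ∀ u {w g} → MatchesSuffix w g → MatchesSuffix (u ++ w) g
matchesSuffix-++ u (π , s , (x , w≡xs) , πs≡g) =
  π , s , (u ++ x , trans (cong (u ++_) w≡xs) (sym (++-assoc u x s))) , πs≡g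

matchesSuffix-square : ∀ {p} u y {g} → Ctilde p (u ++ y ++ y) → p < length y → InΓ p g →
                       MatchesSuffix (u ++ y ++ y) g → MatchesSuffix (y ++ y) g
matchesSuffix-square u y C p<|y| Γg (π , s , (x , uyy≡xs) , πs≡g)
  with suffixes-comparable x s u (y ++ y) (sym uyy≡xs)
... | inj₂ yy-suffix = π , s , yy-suffix , πs≡g
... | inj₁ (t , s≡tyy) =
  let n , 1≤n , n≤p , Pg = Γ-hasPeriod Γg
      Ps = hasPeriod-map⁻ (Injection.injective (↔⇒↣ π)) s (subst (λ v → HasPeriod v n) (sym πs≡g) Pg)
  in  contradiction (hasPeriod-++⁻ʳ t (subst (λ v → HasPeriod v n) s≡tyy Ps))
                    (square-noShortPeriod y (Ctilde-++⁻ʳ u C) p<|y| 1≤n n≤p)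

IsΓOf-transfer : ∀ {p v w} →
                 (∀ g → InΓ p g → MatchesSuffix v g → MatchesSuffix w g) →
                 (∀ g → InΓ p g → MatchesSuffix w g → MatchesSuffix v g) →
                 ∀ {g} → IsΓOf p v g → IsΓOf p w g
IsΓOf-transfer v⇒w w⇒v (Γg , match , longest) =
  Γg , v⇒w _ Γg match , λ g′ Γg′ match′ → longest g′ Γg′ (w⇒v g′ Γg′ match′)

IsΓOf-square : ∀ {p} u y → Ctilde p (u ++ y ++ y) → p < length y →
               ∀ g → IsΓOf p (u ++ y ++ y) g ⇔ IsΓOf p (y ++ y) g
IsΓOf-square u y C p<|y| g = mk⇔ (IsΓOf-transfer shorten lengthen) (IsΓOf-transfer lengthen shorten)
  where
  shorten : ∀ g → InΓ _ g → MatchesSuffix (u ++ y ++ y) g → MatchesSuffix (y ++ y) g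
  shorten g Γg = matchesSuffix-square u y C p<|y| Γg
  lengthen : ∀ g → InΓ _ g → MatchesSuffix (y ++ y) g → MatchesSuffix (u ++ y ++ y) g
  lengthen g _ = matchesSuffix-++ u

lemma3 : ∀ (v : Word) (a : ℕ) → CubeFree v → Ctilde 12 (v ++ [ a ]) →
           ∀ (u y : Word) → v ++ [ a ] ≡ u ++ y ++ y → 12 < length y →
           ∀ (g : Word) → IsΓOf 12 (v ++ [ a ]) g ⇔ IsΓOf 12 (y ++ y) g
lemma3 v a _ C u y va≡uyy 12<|y| g =
  subst (λ w → IsΓOf 12 w g ⇔ IsΓOf 12 (y ++ y) g) (sym va≡uyy)
        (IsΓOf-square u y (subst (Ctilde 12) va≡uyy C) 12<|y| g)
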